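{- There exist a signature $\Sigma$ and a $\Sigma$-theory $\mathcal{T}$ such that some $\mathcal{T}$-language is not $\mathcal{T}$-regular.
   Context: Signatures are multi-sorted first-order signatures in which every symbol is marked either rigid or non-rigid. For a signature $\Sigma$, $\Sigma'$ denotes the signature obtained from $\Sigma$ by replacing each non-rigid symbol $s$ by a fresh primed copy $s'$ (rigid symbols are kept); for a $\Sigma$-structure $\sigma$, $\sigma'$ denotes the corresponding renamed $\Sigma'$-structure. For structures over pairwise disjoint signatures with the same sort domains, $\rho\cup\sigma\cup\tau'$ denotes the combined structure over the union of the signatures. A $\Sigma$-theory $\mathcal{T}$ is a set of $\Sigma$-sentences; $[\![\mathcal{T}]\!]$ is the set of all $\Sigma$-structures with finite or countably infinite domains that satisfy $\mathcal{T}$. A $\mathcal{T}$-word is a finite sequence $\bar\sigma=\langle\sigma_0,\ldots,\sigma_{n-1}\rangle$ ($n\ge 0$) of elements of $[\![\mathcal{T}]\!]$ such that for every sort $S$ and every rigid symbol $s$ of $\Sigma$, $S^{\sigma_i}=S^{\sigma_j}$ and $s^{\sigma_i}=s^{\sigma_j}$ for all $i,j$. $[\![\mathcal{T}]\!]^*$ is the set of all $\mathcal{T}$-words; a $\mathcal{T}$-language is a subset of $[\![\mathcal{T}]\!]^*$. A first-order automaton is a tuple $\mathcal{A}=\langle\Sigma,\Gamma,\phi_0,\phi_T,\phi_F\rangle$ where $\Sigma$ (word signature) and $\Gamma$ (state signature) are finite disjoint signatures, $\phi_0$ and $\phi_F$ are first-order $\Gamma$-sentences, and $\phi_T$ is a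 first-order $(\Gamma\cup\Sigma\cup\Gamma')$-sentence. Given a $\mathcal{T}$-word $\bar\sigma=\langle\sigma_0,\ldots,\sigma_{n-1}\rangle$, a $\mathcal{T}$-run of $\mathcal{A}$ induced by $\bar\sigma$ is a sequence $\langle\rho_0,\ldots,\rho_n\rangle$ of $\Gamma$-structures such that $S^{\rho_i}=S^{\sigma_0}$ for every sort $S$ and every $i$, rigid symbols of $\Gamma$ are interpreted identically in all $\rho_i$, $\rho_0\models\phi_0$, and $\rho_i\cup\sigma_i\cup\rho'_{i+1}\models\phi_T$ for all $0\le i<n$. $\mathcal{A}$ $\mathcal{T}$-accepts $\bar\sigma$ iff some such run satisfies $\rho_n\models\phi_F$. $\mathcal{L}_{\mathcal{T}}(\mathcal{A})$ is the set of $\mathcal{T}$-words $\mathcal{T}$-accepted by $\mathcal{A}$. A $\mathcal{T}$-language $L$ is $\mathcal{T}$-regular iff $L=\mathcal{L}_{\mathcal{T}}(\mathcal{A})$ for some first-order automaton $\mathcal{A}$ with word signature $\Sigma$. -}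

module Defs where

open import Level using (Level; 0ℓ; Lift) renaming (suc to lsuc)
open import Data.Nat using (ℕ)
open import Data.Fin using (Fin)
open import Data.List using (List; []; _∷_)
open import Data.List.Membership.Propositional using (_∈_)
open import Data.List.Relation.Unary.All using (All; []; _∷_; lookup)
open import Data.Product using (Σ; Σ-syntax; _×_; _,_)
open import Data.Sum using (_⊎_; inj₁; inj₂; [_,_])
open import Data.Empty using (⊥)
open import Data.Unit using (⊤)
open import Function.Definitions using (Injective)
open import Function.Bundles using (_⇔_)
open import Relation.Binary.PropositionalEquality using (_≡_)
open import Relation.Nullary using (¬_)

record Vocab (k : ℕ) : Set₁ where
  field
    Fun   : Set
    fArgs : Fun → List (Fin k)
    fRes  : Fun → Fin k
    Pred  : Set
    pArgs : Pred → List (Fin k)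
open Vocab public

record FinVocab (k : ℕ) : Set where
  field
    nFun  : ℕ
    fArgs : Fin nFun → List (Fin k)
    fRes  : Fin nFun → Fin k
    nPred : ℕ
    pArgs : Fin nPred → List (Fin k)

toVocab : ∀ {k} → FinVocab k → Vocab k
toVocab V = record
  { Fun = Fin (FinVocab.nFun V) ; fArgs = FinVocab.fArgs V ; fRes = FinVocab.fRes V
  ; Pred = Fin (FinVocab.nPred V) ; pArgs = FinVocab.pArgs V }

_⊎V_ : ∀ {k} → Vocab k → Vocab k → Vocab k
V ⊎V W = record
  { Fun = Fun V ⊎ Fun W ; fArgs = [ fArgs V , fArgs W ] ; fRes = [ fRes V , fRes W ]
  ; Pred = Pred V ⊎ Pred W ; pArgs = [ pArgs V , pArgs W ] }

record Signature : Set where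
  field
    nSorts : ℕ
    rig    : FinVocab nSorts
    nonrig : FinVocab nSorts
open Signature public

fullV : (S : Signature) → Vocab (nSorts S)
fullV S = toVocab (rig S) ⊎V toVocab (nonrig S)

module _ {k : ℕ} (V : Vocab k) where
  mutual
    data Term (Δ : List (Fin k)) : Fin k → Set where
      var : ∀ {s} → s ∈ Δ → Term Δ s
      app : (f : Fun V) → Terms Δ (fArgs V f) → Term Δ (fRes V f)

    data Terms (Δ : List (Fin k)) : List (Fin k) → Set where
      []  : Terms Δ []
      _∷_ : ∀ {s ss} → Term Δ s → Terms Δ ss → Terms Δ (s ∷ ss)

  data Formula (Δ : List (Fin k)) : Set where
    tt ff     : Formula Δ
    _≐_       : ∀ {s} → Term Δ s → Term Δ s → Formula Δ
    rel       : (p : Pred V) → Terms Δ (pArgs V p) → Formula Δ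
    ~_        : Formula Δ → Formula Δ
    _∧_ _∨_ _⇒_ : Formula Δ → Formula Δ → Formula Δ
    all ex    : (s : Fin k) → Formula (s ∷ Δ) → Formula Δ

  Sentence : Set
  Sentence = Formula []

record Interp {k : ℕ} (V : Vocab k) (D : Fin k → Set) : Set₁ where
  field
    fun  : (f : Fun V) → All D (fArgs V f) → D (fRes V f)
    pred : (p : Pred V) → All D (pArgs V p) → Set
open Interp public

_∪_ : ∀ {k} {V W : Vocab k} {D : Fin k → Set} →
      Interp V D → Interp W D → Interp (V ⊎V W) D
I ∪ J = record { fun = [ fun I , fun J ] ; pred = [ pred I , pred J ] }

module _ {k : ℕ} {V : Vocab k} {D : Fin k → Set} (I : Interp V D) where
  mutual
    evalT : ∀ {Δ s} → All D Δ → Term V Δ s → D s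
    evalT ρ (var x)    = lookup ρ x
    evalT ρ (app f ts) = fun I f (evalTs ρ ts)

    evalTs : ∀ {Δ ss} → All D Δ → Terms V Δ ss → All D ss
    evalTs ρ []       = []
    evalTs ρ (t ∷ ts) = evalT ρ t ∷ evalTs ρ ts

  Sat : ∀ {Δ} → All D Δ → Formula V Δ → Set
  Sat ρ tt         = ⊤
  Sat ρ ff         = ⊥
  Sat ρ (t ≐ u)    = evalT ρ t ≡ evalT ρ u
  Sat ρ (rel p ts) = pred I p (evalTs ρ ts)
  Sat ρ (~ φ)      = ¬ Sat ρ φ
  Sat ρ (φ ∧ ψ)    = Sat ρ φ × Sat ρ ψ
  Sat ρ (φ ∨ ψ)    = Sat ρ φ ⊎ Sat ρ ψ
  Sat ρ (φ ⇒ ψ)    = Sat ρ φ → Sat ρ ψ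
  Sat ρ (all s φ)  = (a : D s) → Sat (a ∷ ρ) φ
  Sat ρ (ex s φ)   = Σ[ a ∈ D s ] Sat (a ∷ ρ) φ

  _⊨_ : Sentence V → Set
  _⊨_ φ = Sat [] φ

Theory : Signature → Set₁
Theory S = Sentence (fullV S) → Set

Countable : ∀ {k} → (Fin k → Set) → Set
Countable {k} D = (s : Fin k) → Σ[ f ∈ (D s → ℕ) ] Injective _≡_ _≡_ f

-- A nonempty word is given by the
-- common sort domains D, the common interpretation r of the rigid symbols,
-- and the interpretations of the non-rigid symbols at each position
-- (first letter σ, remaining letters σs).  This encodes exactly the
-- requirement that all σ_i share sort domains and rigid interpretations.
data Word (S : Signature) : Set₁ where
  ε    : Word S
  word : (D : Fin (nSorts S) → Set) →
         Interp (toVocab (rig S)) D →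
         Interp (toVocab (nonrig S)) D →
         List (Interp (toVocab (nonrig S)) D) → Word S

InModels : {S : Signature} → Theory S → (D : Fin (nSorts S) → Set) →
           Interp (toVocab (rig S)) D → Interp (toVocab (nonrig S)) D → Set
InModels T D r n = Countable D × ((φ : Sentence _) → T φ → (r ∪ n) ⊨ φ)

IsTWord : {S : Signature} → Theory S → Word S → Set₁
IsTWord T ε              = Lift _ ⊤
IsTWord T (word D r σ σs) = InModels T D r σ × All (InModels T D r) σs

Language : Signature → Set₂
Language S = Word S → Set₁

IsTLanguage : {S : Signature} → Theory S → Language S → Set₁
IsTLanguage T L = ∀ w → L w → IsTWord T w

record StateSig (S : Signature) : Set where
  field
    rigΓ    : FinVocab (nSorts S)
    nonrigΓ : FinVocab (nSorts S)
open StateSig public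

fullΓ : {S : Signature} → StateSig S → Vocab (nSorts S)
fullΓ G = toVocab (rigΓ G) ⊎V toVocab (nonrigΓ G)

-- Γ ∪ Σ ∪ Γ' : Γ' consists of primed copies of the non-rigid symbols of Γ
-- (rigid symbols of Γ are shared with Γ)
transV : (S : Signature) → StateSig S → Vocab (nSorts S)
transV S G = (fullΓ G ⊎V fullV S) ⊎V toVocab (nonrigΓ G)

record Automaton (S : Signature) : Set where
  field
    Γ  : StateSig S
    φ₀ : Sentence (fullΓ Γ)
    φT : Sentence (transV S Γ)
    φF : Sentence (fullΓ Γ)
open Automaton public

module _ {S : Signature} (A : Automaton S) {D : Fin (nSorts S) → Set}
         (r : Interp (toVocab (rig S)) D)
         (g : Interp (toVocab (rigΓ (Γ A))) D) where
  Reach : Interp (toVocab (nonrigΓ (Γ A))) D →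
          List (Interp (toVocab (nonrig S)) D) → Set₁
  Reach ρ []       = Lift _ ((g ∪ ρ) ⊨ φF A)
  Reach ρ (σ ∷ σs) = Σ[ ρ' ∈ Interp (toVocab (nonrigΓ (Γ A))) D ]
                       ((((g ∪ ρ) ∪ (r ∪ σ)) ∪ ρ') ⊨ φT A) × Reach ρ' σs

-- A accepts w (the T-word condition is imposed separately in Regular).
-- For the empty word there is no σ₀ fixing the domains; we read it as:
-- some Γ-structure with countable domains satisfies φ₀ and φF.
Accepts : {S : Signature} → Automaton S → Word S → Set₁
Accepts {S} A ε = Σ[ D ∈ (Fin (nSorts S) → Set) ] Countable D ×
                  Σ[ g ∈ Interp (toVocab (rigΓ (Γ A))) D ]
                  Σ[ ρ ∈ Interp (toVocab (nonrigΓ (Γ A))) D ]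
                  ((g ∪ ρ) ⊨ φ₀ A) × ((g ∪ ρ) ⊨ φF A)
Accepts {S} A (word D r σ σs) =
  Σ[ g ∈ Interp (toVocab (rigΓ (Γ A))) D ]
  Σ[ ρ₀ ∈ Interp (toVocab (nonrigΓ (Γ A))) D ]
  ((g ∪ ρ₀) ⊨ φ₀ A) × Reach A r g ρ₀ (σ ∷ σs)

Regular : {S : Signature} → Theory S → Language S → Set₁
Regular {S} T L = Σ[ A ∈ Automaton S ] ((w : Word S) → L w ⇔ (IsTWord T w × Accepts A w))

-- Over a signature with no sorts a structure is just a truth assignment to its nullary
-- predicates, so an automaton with q non-rigid state predicates has at most 2^q states up to
-- logical equivalence. An accepting run on a word of length 2^(1+q) therefore repeats a state
-- within its first 2^q steps, and cutting out that loop yields an accepted word whose length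
-- lies strictly between 2^q and 2^(1+q). So no automaton recognises the words of power-of-two
-- length. The pigeonhole step has to decide arbitrary propositions, so it is carried out under
-- a double negation, which is harmless since the goal is ⊥.
module Submission where

open import Defs
open import Data.Product using (Σ-syntax; _×_; ∃; ∃₂; _,_; proj₂)
open import Relation.Nullary using (¬_; Dec; yes; no)

open import Level using (Lift; lift; lower)
open import Data.Nat as ℕ using (ℕ; zero; suc; _+_; _∸_; _^_; _≤_; _<_; z≤n; s≤s; z<s; s≤s⁻¹; _≤?_)
open import Data.Nat.Properties
open import Data.Fin as Fin using (Fin; toℕ; funToFin; finToFun)
open import Data.Fin.Properties using (pigeonhole; finToFun-funToFin; toℕ<n; sequence)
open import Data.List using (List; []; _∷_; _++_; take; drop; replicate; length)
open import Data.List.Properties using (length-drop; length-replicate)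
open import Data.List.Relation.Unary.All as All using (All; []; _∷_)
open import Data.Sum using (inj₁; inj₂)
open import Data.Empty using (⊥; ⊥-elim)
open import Data.Unit using (tt)
open import Effect.Applicative using (RawApplicative)
open import Effect.Monad using (RawMonad)
open import Function using (_∘_; case_of_)
open import Function.Bundles using (_⇔_; mk⇔; Equivalence)
import Function.Properties.Equivalence as ⇔
open import Relation.Binary.PropositionalEquality
open import Relation.Nullary.Decidable using (¬¬-excluded-middle)
open import Relation.Nullary.Negation using (DoubleNegation; ¬¬-map; ¬¬-Monad)

module _ {k : ℕ} {V : Vocab k} {D : Fin k → Set} where

  record _≈_ (I J : Interp V D) : Set where
    field
      fun-≡  : ∀ f as → fun I f as ≡ fun J f as
      pred-⇔ : ∀ p as → pred I p as ⇔ pred J p as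
  open _≈_

  ≈-refl : ∀ {I} → I ≈ I
  ≈-refl = record { fun-≡ = λ _ _ → refl ; pred-⇔ = λ _ _ → ⇔.refl }

  ≈-sym : ∀ {I J} → I ≈ J → J ≈ I
  ≈-sym I≈J = record
    { fun-≡ = λ f as → sym (fun-≡ I≈J f as) ; pred-⇔ = λ p as → ⇔.sym (pred-⇔ I≈J p as) }

  module _ {I J : Interp V D} (I≈J : I ≈ J) where
    mutual
      evalT-resp-≈ : ∀ {Δ s} (ρ : All D Δ) (t : Term V Δ s) → evalT I ρ t ≡ evalT J ρ t
      evalT-resp-≈ ρ (var x)    = refl
      evalT-resp-≈ ρ (app f ts) = trans (fun-≡ I≈J f _) (cong (fun J f) (evalTs-resp-≈ ρ ts))

      evalTs-resp-≈ : ∀ {Δ ss} (ρ : All D Δ) (ts : Terms V Δ ss) → evalTs I ρ ts ≡ evalTs J ρ ts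
      evalTs-resp-≈ ρ []       = refl
      evalTs-resp-≈ ρ (t ∷ ts) = cong₂ _∷_ (evalT-resp-≈ ρ t) (evalTs-resp-≈ ρ ts)

  Sat-resp-≈ : ∀ {I J} → I ≈ J → ∀ {Δ} (ρ : All D Δ) (φ : Formula V Δ) → Sat I ρ φ → Sat J ρ φ
  Sat-resp-≈ I≈J ρ tt         _         = tt
  Sat-resp-≈ I≈J ρ ff         ()
  Sat-resp-≈ I≈J ρ (t ≐ u)    t≡u       =
    trans (sym (evalT-resp-≈ I≈J ρ t)) (trans t≡u (evalT-resp-≈ I≈J ρ u))
  Sat-resp-≈ {J = J} I≈J ρ (rel p ts) holds =
    subst (pred J p) (evalTs-resp-≈ I≈J ρ ts) (Equivalence.to (pred-⇔ I≈J p _) holds)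
  Sat-resp-≈ I≈J ρ (~ φ)      ¬φ        = ¬φ ∘ Sat-resp-≈ (≈-sym I≈J) ρ φ
  Sat-resp-≈ I≈J ρ (φ ∧ ψ)    (a , b)   = Sat-resp-≈ I≈J ρ φ a , Sat-resp-≈ I≈J ρ ψ b
  Sat-resp-≈ I≈J ρ (φ ∨ ψ)    (inj₁ a)  = inj₁ (Sat-resp-≈ I≈J ρ φ a)
  Sat-resp-≈ I≈J ρ (φ ∨ ψ)    (inj₂ b)  = inj₂ (Sat-resp-≈ I≈J ρ ψ b)
  Sat-resp-≈ I≈J ρ (φ ⇒ ψ)    φ→ψ       =
    Sat-resp-≈ I≈J ρ ψ ∘ φ→ψ ∘ Sat-resp-≈ (≈-sym I≈J) ρ φ
  Sat-resp-≈ I≈J ρ (all s φ)  h         = λ a → Sat-resp-≈ I≈J (a ∷ ρ) φ (h a)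
  Sat-resp-≈ I≈J ρ (ex s φ)   (a , h)   = a , Sat-resp-≈ I≈J (a ∷ ρ) φ h

∪-resp-≈ : ∀ {k} {V W : Vocab k} {D : Fin k → Set} {I I′ : Interp V D} {J J′ : Interp W D} →
           I ≈ I′ → J ≈ J′ → (I ∪ J) ≈ (I′ ∪ J′)
∪-resp-≈ I≈I′ J≈J′ = record
  { fun-≡  = λ { (inj₁ f) → _≈_.fun-≡ I≈I′ f ; (inj₂ f) → _≈_.fun-≡ J≈J′ f }
  ; pred-⇔ = λ { (inj₁ p) → _≈_.pred-⇔ I≈I′ p ; (inj₂ p) → _≈_.pred-⇔ J≈J′ p }
  }

module _ {D : Fin 0 → Set} where

  tuple₀ : (ss : List (Fin 0)) → All D ss
  tuple₀ []      = []
  tuple₀ (() ∷ _)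

  tuple₀-unique : (ss : List (Fin 0)) (as bs : All D ss) → as ≡ bs
  tuple₀-unique []      [] [] = refl
  tuple₀-unique (() ∷ _) _ _

  nullary-≈ : {V : Vocab 0} {I J : Interp V D} →
              (∀ p → pred I p (tuple₀ _) ⇔ pred J p (tuple₀ _)) → I ≈ J
  nullary-≈ {V} {I} {J} same = record
    { fun-≡  = λ f → case fRes V f of λ ()
    ; pred-⇔ = λ p as → subst (λ as → pred I p as ⇔ pred J p as)
                              (tuple₀-unique _ _ as) (same p)
    }

decToFin2 : ∀ {A : Set} → Dec A → Fin 2
decToFin2 (yes _) = Fin.zero
decToFin2 (no _)  = Fin.suc Fin.zero

decToFin2-≡⇒⇔ : ∀ {A B : Set} (a? : Dec A) (b? : Dec B) → decToFin2 a? ≡ decToFin2 b? → A ⇔ B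
decToFin2-≡⇒⇔ (yes a) (yes b) _ = mk⇔ (λ _ → b) (λ _ → a)
decToFin2-≡⇒⇔ (no ¬a) (no ¬b) _ = mk⇔ (⊥-elim ∘ ¬a) (⊥-elim ∘ ¬b)
decToFin2-≡⇒⇔ (yes _) (no _)  ()
decToFin2-≡⇒⇔ (no _)  (yes _) ()

module _ (V : FinVocab 0) {D : Fin 0 → Set} where

  ≈-pigeonhole : (s : Fin (suc (2 ^ FinVocab.nPred V)) → Interp (toVocab V) D) →
                 ¬ ¬ (∃₂ λ i j → i Fin.< j × s i ≈ s j)
  ≈-pigeonhole s = ¬¬-map collide (sequence ¬¬-applicative λ i →
                                   sequence ¬¬-applicative λ p → ¬¬-excluded-middle)
    where
    ¬¬-applicative : RawApplicative DoubleNegation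
    ¬¬-applicative = RawMonad.rawApplicative ¬¬-Monad

    Holds : Fin (suc (2 ^ FinVocab.nPred V)) → Fin (FinVocab.nPred V) → Set
    Holds i p = pred (s i) p (tuple₀ _)

    collide : (∀ i p → Dec (Holds i p)) → ∃₂ λ i j → i Fin.< j × s i ≈ s j
    collide holds? with pigeonhole ≤-refl (λ i → funToFin (decToFin2 ∘ holds? i))
    ... | i , j , i<j , sameCode = i , j , i<j , nullary-≈ λ p →
      decToFin2-≡⇒⇔ (holds? i p) (holds? j p) (begin
        decToFin2 (holds? i p)                                ≡⟨ finToFun-funToFin (decToFin2 ∘ holds? i) p ⟨
        finToFun (funToFin (decToFin2 ∘ holds? i)) p          ≡⟨ cong (λ c → finToFun c p) sameCode ⟩
        finToFun (funToFin (decToFin2 ∘ holds? j)) p          ≡⟨ finToFun-funToFin (decToFin2 ∘ holds? j) p ⟩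
        decToFin2 (holds? j p)                                ∎)
      where open ≡-Reasoning

length-take-++-drop : ∀ {a} {A : Set a} {i j} (xs : List A) → i ≤ j → j ≤ length xs →
                      length (take i xs ++ drop j xs) + (j ∸ i) ≡ length xs
length-take-++-drop {i = zero} {j} xs _ j≤∣xs∣ =
  trans (cong (_+ j) (length-drop j xs)) (m∸n+n≡m j≤∣xs∣)
length-take-++-drop {i = suc i} {suc j} (x ∷ xs) (s≤s i≤j) (s≤s j≤∣xs∣) =
  cong suc (length-take-++-drop xs i≤j j≤∣xs∣)

State : {S : Signature} → Automaton S → (Fin (nSorts S) → Set) → Set₁
State A D = Interp (toVocab (nonrigΓ (Γ A))) D

Letter : (S : Signature) → (Fin (nSorts S) → Set) → Set₁
Letter S D = Interp (toVocab (nonrig S)) D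

module Runs {S : Signature} (A : Automaton S) {D : Fin (nSorts S) → Set}
            (r : Interp (toVocab (rig S)) D) (g : Interp (toVocab (rigΓ (Γ A))) D) where

  Reach-resp-≈ : ∀ {ρ ρ′ : State A D} {xs} → ρ ≈ ρ′ → Reach A r g ρ xs → Reach A r g ρ′ xs
  Reach-resp-≈ {xs = []}    ρ≈ρ′ (lift final) = lift (Sat-resp-≈ (∪-resp-≈ ≈-refl ρ≈ρ′) [] (φF A) final)
  Reach-resp-≈ {xs = _ ∷ _} ρ≈ρ′ (ρ₁ , step , run) =
    ρ₁ , Sat-resp-≈ (∪-resp-≈ (∪-resp-≈ (∪-resp-≈ ≈-refl ρ≈ρ′) ≈-refl) ≈-refl) [] (φT A) step , run

  -- Positions past the end of the word all carry the final state.
  stateAt : ∀ {ρ xs} → Reach A r g ρ xs → ℕ → State A D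
  stateAt {ρ}          _             zero    = ρ
  stateAt {ρ} {[]}     _             (suc i) = ρ
  stateAt {xs = _ ∷ _} (_ , _ , run) (suc i) = stateAt run i

  Reach-drop : ∀ {ρ xs} (run : Reach A r g ρ xs) j → Reach A r g (stateAt run j) (drop j xs)
  Reach-drop              run           zero    = run
  Reach-drop {xs = []}    run           (suc j) = run
  Reach-drop {xs = _ ∷ _} (_ , _ , run) (suc j) = Reach-drop run j

  Reach-removeLoop : ∀ {ρ xs} (run : Reach A r g ρ xs) {i j} → i ≤ j →
                     stateAt run i ≈ stateAt run j → Reach A r g ρ (take i xs ++ drop j xs)
  Reach-removeLoop run {zero} {j} _ loop = Reach-resp-≈ (≈-sym loop) (Reach-drop run j)
  Reach-removeLoop {xs = []} run {suc i} {suc j} _ _ = run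
  Reach-removeLoop {xs = _ ∷ _} (ρ₁ , step , run) {suc i} {suc j} (s≤s i≤j) loop =
    ρ₁ , step , Reach-removeLoop run i≤j loop

stateBound : ∀ {S} → Automaton S → ℕ
stateBound A = 2 ^ FinVocab.nPred (nonrigΓ (Γ A))

propositionalSignature : (R N : FinVocab 0) → Signature
propositionalSignature R N = record { nSorts = 0 ; rig = R ; nonrig = N }

module _ {R N : FinVocab 0} (A : Automaton (propositionalSignature R N))
         {D : Fin 0 → Set} {r : Interp (toVocab R) D} {g : Interp (toVocab (rigΓ (Γ A))) D} where
  open Runs A r g

  ShorterRun : State A D → List (Letter (propositionalSignature R N) D) → Set₁
  ShorterRun ρ xs = ∃₂ λ ys d → Reach A r g ρ ys × 0 < d × d ≤ stateBound A × length ys + d ≡ length xs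

  Reach-pumpDown : ∀ {ρ xs} → Reach A r g ρ xs → stateBound A ≤ length xs → ¬ ¬ ShorterRun ρ xs
  Reach-pumpDown {ρ} {xs} run long =
    ¬¬-map removeLoop (≈-pigeonhole (nonrigΓ (Γ A)) (stateAt run ∘ toℕ))
    where
    removeLoop : (∃₂ λ i j → i Fin.< j × stateAt run (toℕ i) ≈ stateAt run (toℕ j)) → ShorterRun ρ xs
    removeLoop (i , j , i<j , loop) =
      take (toℕ i) xs ++ drop (toℕ j) xs , toℕ j ∸ toℕ i ,
      Reach-removeLoop run (<⇒≤ i<j) loop , m<n⇒0<n∸m i<j ,
      ≤-trans (m∸n≤m (toℕ j) (toℕ i)) j≤stateBound ,
      length-take-++-drop xs (<⇒≤ i<j) (≤-trans j≤stateBound long)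
      where
      j≤stateBound : toℕ j ≤ stateBound A
      j≤stateBound = s≤s⁻¹ (toℕ<n j)

IsPowerOf2 : ℕ → Set
IsPowerOf2 n = ∃ λ j → n ≡ 2 ^ j

n<2^n : ∀ n → n < 2 ^ n
n<2^n zero    = z<s
n<2^n (suc n) = +-mono-≤-< (m^n>0 2 n) (≤-trans (n<2^n n) (≤-reflexive (sym (+-identityʳ (2 ^ n)))))

strictlyBetween⇒¬IsPowerOf2 : ∀ {m n} → 2 ^ m < n → n < 2 ^ suc m → ¬ IsPowerOf2 n
strictlyBetween⇒¬IsPowerOf2 {m} lo hi (j , refl) with j ≤? m
... | yes j≤m = <⇒≱ lo (^-monoʳ-≤ 2 j≤m)
... | no  j≰m = <⇒≱ hi (^-monoʳ-≤ 2 (≰⇒> j≰m))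

n+d≡2^[1+m]⇒2^m<n<2^[1+m] : ∀ {m n d} → 0 < d → d ≤ m → n + d ≡ 2 ^ suc m →
                        2 ^ m < n × n < 2 ^ suc m
n+d≡2^[1+m]⇒2^m<n<2^[1+m] {m} {n} {d} 0<d d≤m n+d≡ =
  +-cancelʳ-< d (2 ^ m) n (begin-strict
    2 ^ m + d          <⟨ +-monoʳ-< (2 ^ m) (≤-<-trans d≤m (n<2^n m)) ⟩
    2 ^ m + 2 ^ m      ≡⟨ cong (2 ^ m +_) (+-identityʳ (2 ^ m)) ⟨
    2 ^ suc m          ≡⟨ n+d≡ ⟨
    n + d              ∎) ,
  (begin-strict
    n                  <⟨ m<m+n n 0<d ⟩
    n + d              ≡⟨ n+d≡ ⟩
    2 ^ suc m          ∎)
  where open ≤-Reasoning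

∅ : FinVocab 0
∅ = record { nFun = 0 ; fArgs = λ () ; fRes = λ () ; nPred = 0 ; pArgs = λ () }

Σ₀ : Signature
Σ₀ = propositionalSignature ∅ ∅

T₀ : Theory Σ₀
T₀ _ = ⊥

IsTWord-T₀ : (w : Word Σ₀) → IsTWord T₀ w
IsTWord-T₀ ε               = lift tt
IsTWord-T₀ (word D r σ σs) = model σ , All.universal model σs
  where
  model : ∀ σ → InModels T₀ D r σ
  model _ = (λ ()) , (λ _ ())

wordLength : ∀ {S} → Word S → ℕ
wordLength ε               = 0
wordLength (word _ _ σ σs) = length (σ ∷ σs)

PowerOf2Length : Language Σ₀
PowerOf2Length w = Lift _ (IsPowerOf2 (wordLength w))

D₀ : Fin 0 → Set
D₀ ()

I₀ : Interp (toVocab ∅) D₀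
I₀ = record { fun = λ () ; pred = λ () }

module PowerOf2LengthNotRecognised
  (A : Automaton Σ₀) (recognises : ∀ w → PowerOf2Length w ⇔ (IsTWord T₀ w × Accepts A w)) where

  accepted⇒IsPowerOf2 : ∀ {g ρ₀} → (g ∪ ρ₀) ⊨ φ₀ A → (ys : List (Letter Σ₀ D₀)) →
                        Reach A I₀ g ρ₀ ys → 0 < length ys → IsPowerOf2 (length ys)
  accepted⇒IsPowerOf2 init (y ∷ ys) run _ =
    lower (Equivalence.from (recognises (word D₀ I₀ y ys)) (IsTWord-T₀ _ , _ , _ , init , run))

  K : ℕ
  K = 2 ^ suc (stateBound A)

  longWord : Word Σ₀
  longWord = word D₀ I₀ I₀ (replicate (ℕ.pred K) I₀)

  longWord-length : wordLength longWord ≡ K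
  longWord-length = trans (cong suc (length-replicate (ℕ.pred K)))
                          (suc-pred K {{m^n≢0 2 (suc (stateBound A))}})

  stateBound≤longWord : stateBound A ≤ wordLength longWord
  stateBound≤longWord = ≤-trans (<⇒≤ (n<2^n (stateBound A)))
                          (≤-trans (^-monoʳ-≤ 2 (n≤1+n (stateBound A))) (≤-reflexive (sym longWord-length)))

  longWord-accepted : Accepts A longWord
  longWord-accepted =
    proj₂ (Equivalence.to (recognises longWord) (lift (suc (stateBound A) , longWord-length)))

  contradiction : ⊥
  contradiction =
    let (_ , _ , init , run) = longWord-accepted
    in Reach-pumpDown A run stateBound≤longWord λ (ys , d , shortRun , 0<d , d≤bound , shorter) →
       let (lo , hi) = n+d≡2^[1+m]⇒2^m<n<2^[1+m] {stateBound A} 0<d d≤bound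
                                                  (trans shorter longWord-length)
       in strictlyBetween⇒¬IsPowerOf2 {stateBound A} lo hi
            (accepted⇒IsPowerOf2 init ys shortRun (≤-<-trans z≤n lo))

theorem1 : Σ[ S ∈ Signature ] Σ[ T ∈ Theory S ] Σ[ L ∈ Language S ] (IsTLanguage T L × ¬ Regular T L)
theorem1 = Σ₀ , T₀ , PowerOf2Length , (λ w _ → IsTWord-T₀ w) ,
           λ (A , recognises) → PowerOf2LengthNotRecognised.contradiction A recognises
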